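{- Let $P$ and $Q$ be Interface Automata and $p\in P$, $q\in Q$. (a) If $P$ and $Q$ have common input and output alphabets and disjoint state sets, then the MIA-conjunction state $[\![p]\!]\wedge[\![q]\!]$ of $[\![P]\!]\wedge[\![Q]\!]$ is defined and $[\![p]\!]\wedge[\![q]\!]=_{\mathrm{MIA}}[\![p\wedge q]\!]$, where $p\wedge q$ is the state of the IA-conjunction $P\wedge Q$. (b) If $P$ and $Q$ are composable and $p$, $q$ are compatible (as IAs), then $[\![p]\!]$ and $[\![q]\!]$ are compatible (as MIAs) and $[\![p]\!]\,|\,[\![q]\!]=_{\mathrm{MIA}}[\![p|q]\!]$.
   Context: IA: $P=(P,I,O,\rightarrow_P)$, states $P$, disjoint action sets $I,O$ not containing $\tau$, $\rightarrow_P\subseteq P\times(I\cup O\cup\{\tau\})\times P$ input-deterministic (for $a\in I$, $p\xrightarrow{a}p'$, $p\xrightarrow{a}p''$ imply $p'=p''$); $p\not\xrightarrow{a}$ means no $a$-transition. IA-conjunction $P\wedge Q$ (common alphabets, disjoint states): states $\{p\wedge q\}\cup P\cup Q$, least transition relation containing $\rightarrow_P,\rightarrow_Q$ with (I1) $p\wedge q\xrightarrow{a}p'$ if $p\xrightarrow{a}_Pp'$, $q\not\xrightarrow{a}_Q$, $a\in I$; (I2) $p\wedge q\xrightarrow{a}q'$ if $p\not\xrightarrow{a}_P$, $q\xrightarrow{a}_Qq'$, $a\in I$; (I3),(O) $p\wedge q\xrightarrow{a}p'\wedge q'$ if $p\xrightarrow{a}_Pp'$, $q\xrightarrow{a}_Qq'$,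 $a\in I\cup O$; (T1) $p\wedge q\xrightarrow{\tau}p'\wedge q$ if $p\xrightarrow{\tau}_Pp'$; (T2) $p\wedge q\xrightarrow{\tau}p\wedge q'$ if $q\xrightarrow{\tau}_Qq'$. IA parallel composition: with $A_j=I_j\cup O_j$, IAs $P_1,P_2$ are composable if $A_1\cap A_2=(I_1\cap O_2)\cup(O_1\cap I_2)$; product $P_1\otimes P_2$ has states $P_1\times P_2$, $I=(I_1\cup I_2)\setminus(O_1\cup O_2)$, $O=(O_1\cup O_2)\setminus(I_1\cup I_2)$, transitions (Par1) $(p_1,p_2)\xrightarrow{\alpha}(p_1',p_2)$ if $p_1\xrightarrow{\alpha}p_1'$, $\alpha\notin A_2$; (Par2) symmetric; (Par3) $(p_1,p_2)\xrightarrow{\tau}(p_1',p_2')$ if $p_1\xrightarrow{a}p_1'$, $p_2\xrightarrow{a}p_2'$. Error state: some $a\in A_1\cap A_2$ with $a\in O_1$, $p_1\xrightarrow{a}$, $p_2\not\xrightarrow{a}$, or $a\in O_2$, $p_2\xrightarrow{a}$, $p_1\not\xrightarrow{a}$. $E$: least set containing error states and states with an $\alpha$-transition ($\alpha\in O\cup\{\tau\}$) into $E$. $P_1|P_2$ removes $E$-states and transitions involving them; $p_1,p_2$ compatible iff $(p_1,p_2)\notin E$, written $p_1|p_2$. MIA: $(P,I,O,\longrightarrow_P,\dashrightarrow_P)$, $I,O$ disjoint, must $\subseteq P\times(I\cup O)\times(2^P\setminus\{\emptyset\})$, may $\subseteq P\times(I\cup O\cup\{\tau\})\times P$, syntactic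 consistency ($p\xrightarrow{a}P'$ implies $p\stackrel{a}{\dashrightarrow}p'$ for $p'\in P'$), and for $i\in I$: at most one $i$-must-transition per state, and $p\stackrel{i}{\dashrightarrow}p'$ implies $p\xrightarrow{i}P'$ with $p'\in P'$. Weak may: $p\stackrel{\epsilon}{\Longrightarrow}p'$ iff $p(\stackrel{\tau}{\dashrightarrow})^*p'$; $p\stackrel{\alpha}{\Longrightarrow}p'$ iff $\exists p''.\,p\stackrel{\epsilon}{\Longrightarrow}p''\stackrel{\alpha}{\dashrightarrow}p'$; $\hat\tau=\epsilon$, $\hat a=a$. $p\sqsubseteq_{\mathrm{MIA}}q$ iff some $\mathcal R$ containing $(p,q)$ satisfies: $q\xrightarrow{a}Q'$ implies some $p\xrightarrow{a}P'$ with $\forall p'\in P'\exists q'\in Q'.(p',q')\in\mathcal R$; $p\stackrel{\alpha}{\dashrightarrow}p'$ with $\alpha\in O\cup\{\tau\}$ implies some $q\stackrel{\hat\alpha}{\Longrightarrow}q'$ with $(p',q')\in\mathcal R$. $p=_{\mathrm{MIA}}q$ iff $p\sqsubseteq_{\mathrm{MIA}}q$ and $q\sqsubseteq_{\mathrm{MIA}}p$. MIA-conjunction: product $P\& Q$ on $(P\times Q)\cup P\cup Q$ inheriting transitions of $P,Q$, plus ($i\in I,o\in O,\alpha\in O\cup\{\tau\}$): (OMust1) $(p,q)\xrightarrow{o}\{(p',q'):p'\in P',q\stackrel{o}{\Longrightarrow}_Qq'\}$ if $p\xrightarrow{o}_PP'$, $q\stackrel{o}{\Longrightarrow}_Q$;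 (OMust2) symmetric; (IMust1) $(p,q)\xrightarrow{i}P'$ if $p\xrightarrow{i}_PP'$, no $i$-must from $q$; (IMust2) symmetric; (IMust3) $(p,q)\xrightarrow{i}P'\times Q'$ if both; (May1) $(p,q)\stackrel{\tau}{\dashrightarrow}(p',q)$ if $p\stackrel{\tau}{\Longrightarrow}_Pp'$; (May2) symmetric; (May3) $(p,q)\stackrel{\alpha}{\dashrightarrow}(p',q')$ if $p\stackrel{\alpha}{\Longrightarrow}_Pp'$, $q\stackrel{\alpha}{\Longrightarrow}_Qq'$; (IMay1) $(p,q)\stackrel{i}{\dashrightarrow}p'$ if $p\stackrel{i}{\dashrightarrow}_Pp'$, no $i$-may from $q$; (IMay2) symmetric; (IMay3) $(p,q)\stackrel{i}{\dashrightarrow}(p',q')$ if both. $F\subseteq P\times Q$ least with: (F1) $p\xrightarrow{o}_P$ and not $q\stackrel{o}{\Longrightarrow}_Q$, $o\in O$; (F2) symmetric; (F3) $(p,q)\xrightarrow{a}R'$ with $R'\subseteq F$. $P\wedge Q$ deletes $F$-states, transitions leaving them, may-transitions entering them, and removes them from must-targets; $p\wedge q$ defined iff $(p,q)\notin F$. MIA parallel composition: composability as for IA; product on $P_1\times P_2$ with same $I,O$: (Must1) $(p_1,p_2)\xrightarrow{a}P_1'\times\{p_2\}$ if $p_1\xrightarrow{a}P_1'$, $a\notin A_2$; (Must2) symmetric; (May1) $(p_1,p_2)\stackrel{\alpha}{\dashrightarrow}(p_1',p_2)$ if $p_1\stackrel{\alpha}{\dashrightarrow}p_1'$, $\alpha\notin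 A_2$; (May2) symmetric; (May3) $(p_1,p_2)\stackrel{\tau}{\dashrightarrow}(p_1',p_2')$ if $p_1\stackrel{a}{\dashrightarrow}p_1'$, $p_2\stackrel{a}{\dashrightarrow}p_2'$. Error state: $a\in A_1\cap A_2$ with $a\in O_1$, $p_1\stackrel{a}{\dashrightarrow}$, no $a$-must from $p_2$ (or symmetric). $E$: least set containing error states and states with an $\alpha$-may-transition ($\alpha\in O\cup\{\tau\}$) into $E$. Pruning removes $E$-states, every transition with such a state as source, target or one of its targets, and all may-transitions underlying a removed must-transition; remaining $(p_1,p_2)$ are compatible, written $p_1|p_2$. Embedding: for an IA $P$, $[\![P]\!]$ is the MIA $(P,I,O,\longrightarrow,\dashrightarrow)$ with $p\xrightarrow{i}p'$ (must) iff $p\xrightarrow{i}_Pp'$, $i\in I$, and $p\stackrel{\alpha}{\dashrightarrow}p'$ iff $p\xrightarrow{\alpha}_Pp'$; $[\![p]\!]$ is $p$ as a state of $[\![P]\!]$. -}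

module Defs where

open import Data.Product using (Σ; _×_; _,_)
open import Data.Sum using (_⊎_)
open import Data.Empty using (⊥)
open import Data.Unit using (⊤)
open import Relation.Nullary using (¬_)
open import Relation.Binary.PropositionalEquality using (_≡_)

data Lab (Act : Set) : Set where
  τ   : Lab Act
  ⟨_⟩ : Act → Lab Act

Pred : Set → Set₁
Pred A = A → Set

_∪_ : {A : Set} → Pred A → Pred A → Pred A
(X ∪ Y) a = X a ⊎ Y a

-- α ∉ A  (τ is in no alphabet)
NotIn : {Act : Set} → Pred Act → Lab Act → Set
NotIn A τ     = ⊤
NotIn A ⟨ a ⟩ = ¬ A a

data OutTau {Act : Set} (O : Pred Act) : Lab Act → Set where
  isτ   : OutTau O τ
  isOut : ∀ {o} → O o → OutTau O ⟨ o ⟩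

record LTS (Act : Set) : Set₁ where
  field
    St : Set
    Tr : St → Lab Act → St → Set
open LTS public

record IsIA {Act : Set} (I O : Pred Act) (P : LTS Act) : Set where
  field
    disjoint : ∀ a → I a → O a → ⊥
    alphabet : ∀ {p a p'} → Tr P p ⟨ a ⟩ p' → (I ∪ O) a
    inputDet : ∀ {p a p' p''} → I a → Tr P p ⟨ a ⟩ p' → Tr P p ⟨ a ⟩ p'' → p' ≡ p''

-- States of a conjunction: {p ∧ q} ∪ P ∪ Q (disjoint union)
data ConjSt (A B : Set) : Set where
  both : A → B → ConjSt A B
  inl  : A → ConjSt A B
  inr  : B → ConjSt A B

module _ {Act : Set} (I O : Pred Act) (P Q : LTS Act) where
  data IAConjStep : ConjSt (St P) (St Q) → Lab Act → ConjSt (St P) (St Q) → Set where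
    I1  : ∀ {p q a p'} → I a → Tr P p ⟨ a ⟩ p' → (∀ q' → ¬ Tr Q q ⟨ a ⟩ q') →
          IAConjStep (both p q) ⟨ a ⟩ (inl p')
    I2  : ∀ {p q a q'} → I a → (∀ p' → ¬ Tr P p ⟨ a ⟩ p') → Tr Q q ⟨ a ⟩ q' →
          IAConjStep (both p q) ⟨ a ⟩ (inr q')
    I3O : ∀ {p q a p' q'} → (I ∪ O) a → Tr P p ⟨ a ⟩ p' → Tr Q q ⟨ a ⟩ q' →
          IAConjStep (both p q) ⟨ a ⟩ (both p' q')
    T1  : ∀ {p q p'} → Tr P p τ p' → IAConjStep (both p q) τ (both p' q)
    T2  : ∀ {p q q'} → Tr Q q τ q' → IAConjStep (both p q) τ (both p q')
    inhP : ∀ {p α p'} → Tr P p α p' → IAConjStep (inl p) α (inl p')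
    inhQ : ∀ {q α q'} → Tr Q q α q' → IAConjStep (inr q) α (inr q')

  IAConj : LTS Act
  IAConj = record { St = ConjSt (St P) (St Q) ; Tr = IAConjStep }

module _ {Act : Set} (I₁ O₁ I₂ O₂ : Pred Act) where
  ParI : Pred Act
  ParI a = (I₁ ∪ I₂) a × ¬ (O₁ ∪ O₂) a

  ParO : Pred Act
  ParO a = (O₁ ∪ O₂) a × ¬ (I₁ ∪ I₂) a

  Composable : Set
  Composable = ∀ a →
    (((I₁ ∪ O₁) a × (I₂ ∪ O₂) a) → ((I₁ a × O₂ a) ⊎ (O₁ a × I₂ a)))
    × (((I₁ a × O₂ a) ⊎ (O₁ a × I₂ a)) → ((I₁ ∪ O₁) a × (I₂ ∪ O₂) a))

module _ {Act : Set} (I₁ O₁ I₂ O₂ : Pred Act) (P₁ P₂ : LTS Act) where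
  private
    A₁ A₂ : Pred Act
    A₁ = I₁ ∪ O₁
    A₂ = I₂ ∪ O₂

  data IAParStep : St P₁ × St P₂ → Lab Act → St P₁ × St P₂ → Set where
    Par1 : ∀ {p₁ p₂ α p₁'} → Tr P₁ p₁ α p₁' → NotIn A₂ α →
           IAParStep (p₁ , p₂) α (p₁' , p₂)
    Par2 : ∀ {p₁ p₂ α p₂'} → Tr P₂ p₂ α p₂' → NotIn A₁ α →
           IAParStep (p₁ , p₂) α (p₁ , p₂')
    Par3 : ∀ {p₁ p₂ a p₁' p₂'} → Tr P₁ p₁ ⟨ a ⟩ p₁' → Tr P₂ p₂ ⟨ a ⟩ p₂' →
           IAParStep (p₁ , p₂) τ (p₁' , p₂')

  data IAError : St P₁ × St P₂ → Set where
    err1 : ∀ {p₁ p₂ a p₁'} → A₁ a → A₂ a → O₁ a → Tr P₁ p₁ ⟨ a ⟩ p₁' →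
           (∀ p₂' → ¬ Tr P₂ p₂ ⟨ a ⟩ p₂') → IAError (p₁ , p₂)
    err2 : ∀ {p₁ p₂ a p₂'} → A₁ a → A₂ a → O₂ a → Tr P₂ p₂ ⟨ a ⟩ p₂' →
           (∀ p₁' → ¬ Tr P₁ p₁ ⟨ a ⟩ p₁') → IAError (p₁ , p₂)

  data IAE : St P₁ × St P₂ → Set where
    E-err  : ∀ {s} → IAError s → IAE s
    E-step : ∀ {s α s'} → OutTau (ParO I₁ O₁ I₂ O₂) α → IAParStep s α s' → IAE s' → IAE s

  IACompatible : St P₁ → St P₂ → Set
  IACompatible p₁ p₂ = ¬ IAE (p₁ , p₂)

  IAPar : LTS Act
  IAPar = record
    { St = Σ (St P₁ × St P₂) (λ s → ¬ IAE s)
    ; Tr = λ { (s , _) α (s' , _) → IAParStep s α s' } }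

-- Must-transitions p ⟶a P' are represented as a family: Must p a is the
-- set of a-must-transitions leaving p, and tgt m ⊆ States is the target
-- set of the must-transition m.

record MIA {Act : Set} (I O : Pred Act) : Set₁ where
  field
    mSt  : Set
    Must : mSt → Act → Set
    tgt  : ∀ {p a} → Must p a → Pred mSt
    May  : mSt → Lab Act → mSt → Set
open MIA public

module _ {Act : Set} {I O : Pred Act} (M : MIA I O) where
  data WeakEps : mSt M → mSt M → Set where
    ε-refl : ∀ {p} → WeakEps p p
    ε-step : ∀ {p p'' p'} → May M p τ p'' → WeakEps p'' p' → WeakEps p p'

  Weak : mSt M → Lab Act → mSt M → Set
  Weak p α p' = Σ (mSt M) λ p'' → WeakEps p p'' × May M p'' α p'

  WeakHat : mSt M → Lab Act → mSt M → Set
  WeakHat p τ p'     = WeakEps p p'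
  WeakHat p ⟨ a ⟩ p' = Weak p ⟨ a ⟩ p'

module _ {Act : Set} {I O : Pred Act} (M N : MIA I O) where
  record IsMIARefinement (R : mSt M → mSt N → Set) : Set where
    field
      must-match : ∀ {p q a} → R p q → (n : Must N q a) →
        Σ (Must M p a) λ m → ∀ p' → tgt M m p' → Σ (mSt N) λ q' → tgt N n q' × R p' q'
      may-match : ∀ {p q α p'} → R p q → OutTau O α → May M p α p' →
        Σ (mSt N) λ q' → WeakHat N q α q' × R p' q'

  Refines : mSt M → mSt N → Set₁
  Refines p q = Σ (mSt M → mSt N → Set) λ R → IsMIARefinement R × R p q

MIAEq : {Act : Set} {I O : Pred Act} (M N : MIA I O) → mSt M → mSt N → Set₁
MIAEq M N p q = Refines M N p q × Refines N M q p

module _ {Act : Set} (I O : Pred Act) (P : LTS Act) where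
  data EmbMust (p : St P) (a : Act) : Set where
    emb : ∀ {p'} → I a → Tr P p ⟨ a ⟩ p' → EmbMust p a

  embTgt : ∀ {p a} → EmbMust p a → Pred (St P)
  embTgt (emb {p'} _ _) x = x ≡ p'

  Embed : MIA I O
  Embed = record { mSt = St P ; Must = EmbMust ; tgt = embTgt ; May = Tr P }

module _ {Act : Set} {I O : Pred Act} (M N : MIA I O) where
  private
    S : Set
    S = ConjSt (mSt M) (mSt N)

  data CMust : S → Act → Set where
    OMust1 : ∀ {p q o} → O o → Must M p o → Σ (mSt N) (Weak N q ⟨ o ⟩) → CMust (both p q) o
    OMust2 : ∀ {p q o} → O o → Must N q o → Σ (mSt M) (Weak M p ⟨ o ⟩) → CMust (both p q) o
    IMust1 : ∀ {p q i} → I i → Must M p i → ¬ Must N q i → CMust (both p q) i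
    IMust2 : ∀ {p q i} → I i → ¬ Must M p i → Must N q i → CMust (both p q) i
    IMust3 : ∀ {p q i} → I i → Must M p i → Must N q i → CMust (both p q) i
    inhMustM : ∀ {p a} → Must M p a → CMust (inl p) a
    inhMustN : ∀ {q a} → Must N q a → CMust (inr q) a

  ctgt : ∀ {s a} → CMust s a → Pred S
  ctgt (OMust1 {q = q} {o} _ m _) (both p' q') = tgt M m p' × Weak N q ⟨ o ⟩ q'
  ctgt (OMust1 _ _ _) _ = ⊥
  ctgt (OMust2 {p = p} {o = o} _ n _) (both p' q') = Weak M p ⟨ o ⟩ p' × tgt N n q'
  ctgt (OMust2 _ _ _) _ = ⊥
  ctgt (IMust1 _ m _) (inl p') = tgt M m p'
  ctgt (IMust1 _ _ _) _ = ⊥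
  ctgt (IMust2 _ _ n) (inr q') = tgt N n q'
  ctgt (IMust2 _ _ _) _ = ⊥
  ctgt (IMust3 _ m n) (both p' q') = tgt M m p' × tgt N n q'
  ctgt (IMust3 _ _ _) _ = ⊥
  ctgt (inhMustM m) (inl p') = tgt M m p'
  ctgt (inhMustM _) _ = ⊥
  ctgt (inhMustN n) (inr q') = tgt N n q'
  ctgt (inhMustN _) _ = ⊥

  data CMay : S → Lab Act → S → Set where
    May1  : ∀ {p q p'} → Weak M p τ p' → CMay (both p q) τ (both p' q)
    May2  : ∀ {p q q'} → Weak N q τ q' → CMay (both p q) τ (both p q')
    May3  : ∀ {p q α p' q'} → OutTau O α → Weak M p α p' → Weak N q α q' →
            CMay (both p q) α (both p' q')
    IMay1 : ∀ {p q i p'} → I i → May M p ⟨ i ⟩ p' → (∀ q' → ¬ May N q ⟨ i ⟩ q') →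
            CMay (both p q) ⟨ i ⟩ (inl p')
    IMay2 : ∀ {p q i q'} → I i → (∀ p' → ¬ May M p ⟨ i ⟩ p') → May N q ⟨ i ⟩ q' →
            CMay (both p q) ⟨ i ⟩ (inr q')
    IMay3 : ∀ {p q i p' q'} → I i → May M p ⟨ i ⟩ p' → May N q ⟨ i ⟩ q' →
            CMay (both p q) ⟨ i ⟩ (both p' q')
    inhMayM : ∀ {p α p'} → May M p α p' → CMay (inl p) α (inl p')
    inhMayN : ∀ {q α q'} → May N q α q' → CMay (inr q) α (inr q')

  data CF : S → Set where
    F1 : ∀ {p q o} → O o → Must M p o → ¬ Σ (mSt N) (Weak N q ⟨ o ⟩) → CF (both p q)
    F2 : ∀ {p q o} → O o → Must N q o → ¬ Σ (mSt M) (Weak M p ⟨ o ⟩) → CF (both p q)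
    F3 : ∀ {p q a} (m : CMust (both p q) a) → (∀ s → ctgt m s → CF s) → CF (both p q)

  ConjDefined : mSt M → mSt N → Set
  ConjDefined p q = ¬ CF (both p q)

  -- P ∧ Q : F-states deleted, with transitions leaving them, may-transitions
  -- entering them, and their removal from must-targets
  MIAConj : MIA I O
  MIAConj = record
    { mSt  = Σ S (λ s → ¬ CF s)
    ; Must = λ { (s , _) a → CMust s a }
    ; tgt  = λ { m (s' , _) → ctgt m s' }
    ; May  = λ { (s , _) α (s' , _) → CMay s α s' } }

module _ {Act : Set} {I₁ O₁ I₂ O₂ : Pred Act} (M₁ : MIA I₁ O₁) (M₂ : MIA I₂ O₂) where
  private
    S : Set
    S = mSt M₁ × mSt M₂
    A₁ A₂ : Pred Act
    A₁ = I₁ ∪ O₁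
    A₂ = I₂ ∪ O₂

  data PMust : S → Act → Set where
    Must1 : ∀ {p₁ p₂ a} → Must M₁ p₁ a → ¬ A₂ a → PMust (p₁ , p₂) a
    Must2 : ∀ {p₁ p₂ a} → Must M₂ p₂ a → ¬ A₁ a → PMust (p₁ , p₂) a

  ptgt : ∀ {s a} → PMust s a → Pred S
  ptgt (Must1 {p₂ = p₂} m _) (p₁' , p₂') = tgt M₁ m p₁' × p₂' ≡ p₂
  ptgt (Must2 {p₁ = p₁} n _) (p₁' , p₂') = p₁' ≡ p₁ × tgt M₂ n p₂'

  data PMay : S → Lab Act → S → Set where
    May1 : ∀ {p₁ p₂ α p₁'} → May M₁ p₁ α p₁' → NotIn A₂ α → PMay (p₁ , p₂) α (p₁' , p₂)
    May2 : ∀ {p₁ p₂ α p₂'} → May M₂ p₂ α p₂' → NotIn A₁ α → PMay (p₁ , p₂) α (p₁ , p₂')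
    May3 : ∀ {p₁ p₂ a p₁' p₂'} → May M₁ p₁ ⟨ a ⟩ p₁' → May M₂ p₂ ⟨ a ⟩ p₂' →
           PMay (p₁ , p₂) τ (p₁' , p₂')

  data MIAError : S → Set where
    err1 : ∀ {p₁ p₂ a p₁'} → A₁ a → A₂ a → O₁ a → May M₁ p₁ ⟨ a ⟩ p₁' →
           ¬ Must M₂ p₂ a → MIAError (p₁ , p₂)
    err2 : ∀ {p₁ p₂ a p₂'} → A₁ a → A₂ a → O₂ a → May M₂ p₂ ⟨ a ⟩ p₂' →
           ¬ Must M₁ p₁ a → MIAError (p₁ , p₂)

  data MIAE : S → Set where
    E-err  : ∀ {s} → MIAError s → MIAE s
    E-step : ∀ {s α s'} → OutTau (ParO I₁ O₁ I₂ O₂) α → PMay s α s' → MIAE s' → MIAE s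

  MIACompatible : mSt M₁ → mSt M₂ → Set
  MIACompatible p₁ p₂ = ¬ MIAE (p₁ , p₂)

  RemovedMust : ∀ {s a} → PMust s a → Set
  RemovedMust m = Σ S λ t → ptgt m t × MIAE t

  UnderlyingRemoved : S → Lab Act → S → Set
  UnderlyingRemoved s τ s' = ⊥
  UnderlyingRemoved s ⟨ a ⟩ s' = Σ (PMust s a) λ m → ptgt m s' × RemovedMust m

  MIAPar : MIA (ParI I₁ O₁ I₂ O₂) (ParO I₁ O₁ I₂ O₂)
  MIAPar = record
    { mSt  = Σ S (λ s → ¬ MIAE s)
    ; Must = λ { (s , _) a → Σ (PMust s a) (λ m → ¬ RemovedMust m) }
    ; tgt  = λ { (m , _) (t , _) → ptgt m t }
    ; May  = λ { (s , _) α (s' , _) → PMay s α s' × ¬ UnderlyingRemoved s α s' } }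

-- In both parts the MIA construction on embedded IAs has, state for state,
-- the same transitions as the IA construction.  Embedded IAs have must-
-- transitions only on inputs, so for conjunction the inconsistency set F
-- is empty (F1, F2 need output musts, and input musts have singleton
-- targets, so F3 never starts), and the weak may-transitions of MIA-
-- conjunction are matched by weak steps of the IA-conjunction interleaving
-- T1 and T2.  For parallel composition, composability makes every shared
-- output of one side an input of the other, where "no must-transition" and
-- "no transition" coincide; hence the MIA and IA error sets E agree, and
-- so do pruning and compatibility.  In both cases the identity on states
-- is a refinement in each direction.

module Submission where

open import Defs
open import Data.Product using (Σ; _×_; _,_; proj₁)
open import Data.Sum using (inj₁; inj₂)
open import Data.Empty using (⊥-elim)
open import Relation.Nullary using (¬_)
open import Relation.Binary.PropositionalEquality using (_≡_; refl)

module _ {Act : Set} {I O : Pred Act} (M : MIA I O) where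

  WeakEps-trans : ∀ {x y z} → WeakEps M x y → WeakEps M y z → WeakEps M x z
  WeakEps-trans ε-refl         w = w
  WeakEps-trans (ε-step t w₁) w = ε-step t (WeakEps-trans w₁ w)

  Weakτ⇒WeakEps : ∀ {x y} → Weak M x τ y → WeakEps M x y
  Weakτ⇒WeakEps (_ , w , t) = WeakEps-trans w (ε-step t ε-refl)

  May⇒Weak : ∀ {x α y} → May M x α y → Weak M x α y
  May⇒Weak t = _ , ε-refl , t

  May⇒WeakHat : ∀ {x α y} → May M x α y → WeakHat M x α y
  May⇒WeakHat {α = τ}     t = ε-step t ε-refl
  May⇒WeakHat {α = ⟨ _ ⟩} t = May⇒Weak t

WeakEps-map : ∀ {Act : Set} {I O I′ O′ : Pred Act} {M : MIA I O} {N : MIA I′ O′}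
  (f : mSt M → mSt N) → (∀ {x y} → May M x τ y → May N (f x) τ (f y)) →
  ∀ {x y} → WeakEps M x y → WeakEps N (f x) (f y)
WeakEps-map f step ε-refl       = ε-refl
WeakEps-map f step (ε-step t w) = ε-step (step t) (WeakEps-map f step w)

Embed-noOutputMust : ∀ {Act : Set} {I O : Pred Act} {P : LTS Act} → IsIA I O P →
  ∀ {p o} → O o → ¬ EmbMust I O P p o
Embed-noOutputMust iP o (emb i _) = IsIA.disjoint iP _ i o

module Conjunction {Act : Set} (I O : Pred Act) (P Q : LTS Act)
                   (iP : IsIA I O P) (iQ : IsIA I O Q) where

  private
    M = Embed I O P
    N = Embed I O Q
    C = MIAConj M N
    E = Embed I O (IAConj I O P Q)

  F-empty : ∀ {s} → ¬ CF M N s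
  F-empty (F1 o m _)                              = Embed-noOutputMust iP o m
  F-empty (F2 o n _)                              = Embed-noOutputMust iQ o n
  F-empty (F3 (OMust1 o m _) _)                   = Embed-noOutputMust iP o m
  F-empty (F3 (OMust2 o n _) _)                   = Embed-noOutputMust iQ o n
  F-empty (F3 (IMust1 _ (emb _ _) _) inF)         = F-empty (inF (inl _) refl)
  F-empty (F3 (IMust2 _ _ (emb _ _)) inF)         = F-empty (inF (inr _) refl)
  F-empty (F3 (IMust3 _ (emb _ _) (emb _ _)) inF) = F-empty (inF (both _ _) (refl , refl))

  defined : ConjSt (St P) (St Q) → mSt C
  defined s = s , F-empty

  input-¬OutTau : ∀ {i} → I i → ¬ OutTau O ⟨ i ⟩
  input-¬OutTau i (isOut o) = IsIA.disjoint iP _ i o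

  lift₁ : ∀ {p p′ q} → WeakEps M p p′ → WeakEps E (both p q) (both p′ q)
  lift₁ {q = q} = WeakEps-map (λ p → both p q) T1

  lift₂ : ∀ {p q q′} → WeakEps N q q′ → WeakEps E (both p q) (both p q′)
  lift₂ {p = p} = WeakEps-map (both p) T2

  SameState : mSt C → mSt E → Set
  SameState (s , _) t = s ≡ t

  SameState⁻¹ : mSt E → mSt C → Set
  SameState⁻¹ t x = SameState x t

  conj⊑IAConj : IsMIARefinement C E SameState
  conj⊑IAConj = record
    { must-match = λ {x} {t} → must {x} {t}
    ; may-match  = λ {x} {t} {α} {x′} → may {x} {t} {α} {x′} }
    where
    must : ∀ {x t a} → SameState x t → (n : Must E t a) →
      Σ (Must C x a) λ m → ∀ x′ → tgt C {x} m x′ →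
        Σ (mSt E) λ t′ → tgt E {t} n t′ × SameState x′ t′
    must refl (emb i (I1 _ tr noQ)) =
      IMust1 i (emb i tr) (λ { (emb _ tr′) → noQ _ tr′ }) ,
      λ { (inl _ , _) refl → _ , refl , refl ; (both _ _ , _) () ; (inr _ , _) () }
    must refl (emb i (I2 _ noP tr)) =
      IMust2 i (λ { (emb _ tr′) → noP _ tr′ }) (emb i tr) ,
      λ { (inr _ , _) refl → _ , refl , refl ; (both _ _ , _) () ; (inl _ , _) () }
    must refl (emb i (I3O _ tr₁ tr₂)) =
      IMust3 i (emb i tr₁) (emb i tr₂) ,
      λ { (both _ _ , _) (refl , refl) → _ , refl , refl ; (inl _ , _) () ; (inr _ , _) () }
    must refl (emb i (inhP tr)) =
      inhMustM (emb i tr) ,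
      λ { (inl _ , _) refl → _ , refl , refl ; (both _ _ , _) () ; (inr _ , _) () }
    must refl (emb i (inhQ tr)) =
      inhMustN (emb i tr) ,
      λ { (inr _ , _) refl → _ , refl , refl ; (both _ _ , _) () ; (inl _ , _) () }

    may : ∀ {x t α x′} → SameState x t → OutTau O α → May C x α x′ →
      Σ (mSt E) λ t′ → WeakHat E t α t′ × SameState x′ t′
    may refl _ (May1 w) = _ , lift₁ (Weakτ⇒WeakEps M w) , refl
    may refl _ (May2 w) = _ , lift₂ (Weakτ⇒WeakEps N w) , refl
    may refl isτ (May3 _ w₁ w₂) =
      _ , WeakEps-trans E (lift₁ (Weakτ⇒WeakEps M w₁)) (lift₂ (Weakτ⇒WeakEps N w₂)) , refl
    may refl (isOut o) (May3 _ (_ , w₁ , tr₁) (_ , w₂ , tr₂)) =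
      _ , (_ , WeakEps-trans E (lift₁ w₁) (lift₂ w₂) , I3O (inj₂ o) tr₁ tr₂) , refl
    may refl ot (IMay1 i _ _)   = ⊥-elim (input-¬OutTau i ot)
    may refl ot (IMay2 i _ _)   = ⊥-elim (input-¬OutTau i ot)
    may refl ot (IMay3 i _ _)   = ⊥-elim (input-¬OutTau i ot)
    may refl _  (inhMayM tr)    = _ , May⇒WeakHat E (inhP tr) , refl
    may refl _  (inhMayN tr)    = _ , May⇒WeakHat E (inhQ tr) , refl

  IAConj⊑conj : IsMIARefinement E C SameState⁻¹
  IAConj⊑conj = record
    { must-match = λ {x} {t} → must {x} {t}
    ; may-match  = λ {x} {t} {α} {x′} → may {x} {t} {α} {x′} }
    where
    must : ∀ {t x a} → SameState⁻¹ t x → (n : Must C x a) →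
      Σ (Must E t a) λ m → ∀ t′ → tgt E {t} m t′ →
        Σ (mSt C) λ x′ → tgt C {x} n x′ × SameState⁻¹ t′ x′
    must refl (OMust1 o m _) = ⊥-elim (Embed-noOutputMust iP o m)
    must refl (OMust2 o n _) = ⊥-elim (Embed-noOutputMust iQ o n)
    must refl (IMust1 i (emb _ tr) noQ) =
      emb i (I1 i tr (λ _ tr′ → noQ (emb i tr′))) , λ { _ refl → defined _ , refl , refl }
    must refl (IMust2 i noP (emb _ tr)) =
      emb i (I2 i (λ _ tr′ → noP (emb i tr′)) tr) , λ { _ refl → defined _ , refl , refl }
    must refl (IMust3 i (emb _ tr₁) (emb _ tr₂)) =
      emb i (I3O (inj₁ i) tr₁ tr₂) , λ { _ refl → defined _ , (refl , refl) , refl }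
    must refl (inhMustM (emb i tr)) = emb i (inhP tr) , λ { _ refl → defined _ , refl , refl }
    must refl (inhMustN (emb i tr)) = emb i (inhQ tr) , λ { _ refl → defined _ , refl , refl }

    may : ∀ {t x α t′} → SameState⁻¹ t x → OutTau O α → May E t α t′ →
      Σ (mSt C) λ x′ → WeakHat C x α x′ × SameState⁻¹ t′ x′
    may refl ot (I1 i _ _) = ⊥-elim (input-¬OutTau i ot)
    may refl ot (I2 i _ _) = ⊥-elim (input-¬OutTau i ot)
    may {x = x} refl ot@(isOut _) (I3O _ tr₁ tr₂) =
      defined (both _ _) , (x , ε-refl , May3 ot (May⇒Weak M tr₁) (May⇒Weak N tr₂)) , refl
    may refl _ (T1 tr)   = defined _ , May⇒WeakHat C (May1 (May⇒Weak M tr)) , refl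
    may refl _ (T2 tr)   = defined _ , May⇒WeakHat C (May2 (May⇒Weak N tr)) , refl
    may refl _ (inhP tr) = defined _ , May⇒WeakHat C (inhMayM tr) , refl
    may refl _ (inhQ tr) = defined _ , May⇒WeakHat C (inhMayN tr) , refl

  Embed-MIAConj-defined-equiv : (p : St P) (q : St Q) →
    Σ (ConjDefined M N p q) λ d → MIAEq C E (both p q , d) (both p q)
  Embed-MIAConj-defined-equiv p q =
    F-empty , (SameState , conj⊑IAConj , refl) , (SameState⁻¹ , IAConj⊑conj , refl)

module Parallel {Act : Set} (I₁ O₁ I₂ O₂ : Pred Act) (P Q : LTS Act)
                (iP : IsIA I₁ O₁ P) (iQ : IsIA I₂ O₂ Q) (comp : Composable I₁ O₁ I₂ O₂) where

  private
    M₁ = Embed I₁ O₁ P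
    M₂ = Embed I₂ O₂ Q
    Par = MIAPar M₁ M₂
    E = Embed (ParI I₁ O₁ I₂ O₂) (ParO I₁ O₁ I₂ O₂) (IAPar I₁ O₁ I₂ O₂ P Q)

  sharedOutput₁⇒input₂ : ∀ {a} → (I₁ ∪ O₁) a → (I₂ ∪ O₂) a → O₁ a → I₂ a
  sharedOutput₁⇒input₂ {a} a₁ a₂ o₁ with proj₁ (comp a) (a₁ , a₂)
  ... | inj₁ (i₁ , _) = ⊥-elim (IsIA.disjoint iP _ i₁ o₁)
  ... | inj₂ (_ , i₂) = i₂

  sharedOutput₂⇒input₁ : ∀ {a} → (I₁ ∪ O₁) a → (I₂ ∪ O₂) a → O₂ a → I₁ a
  sharedOutput₂⇒input₁ {a} a₁ a₂ o₂ with proj₁ (comp a) (a₁ , a₂)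
  ... | inj₁ (i₁ , _) = i₁
  ... | inj₂ (_ , i₂) = ⊥-elim (IsIA.disjoint iQ _ i₂ o₂)

  ParI-private₁ : ∀ {a} → ParI I₁ O₁ I₂ O₂ a → ¬ (I₂ ∪ O₂) a → I₁ a
  ParI-private₁ (inj₁ i₁ , _) _  = i₁
  ParI-private₁ (inj₂ i₂ , _) a∉ = ⊥-elim (a∉ (inj₁ i₂))

  ParI-private₂ : ∀ {a} → ParI I₁ O₁ I₂ O₂ a → ¬ (I₁ ∪ O₁) a → I₂ a
  ParI-private₂ (inj₂ i₂ , _) _  = i₂
  ParI-private₂ (inj₁ i₁ , _) a∉ = ⊥-elim (a∉ (inj₁ i₁))

  private-input₁⇒ParI : ∀ {a} → I₁ a → ¬ (I₂ ∪ O₂) a → ParI I₁ O₁ I₂ O₂ a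
  private-input₁⇒ParI i₁ a∉ =
    inj₁ i₁ , λ { (inj₁ o₁) → IsIA.disjoint iP _ i₁ o₁ ; (inj₂ o₂) → a∉ (inj₂ o₂) }

  private-input₂⇒ParI : ∀ {a} → I₂ a → ¬ (I₁ ∪ O₁) a → ParI I₁ O₁ I₂ O₂ a
  private-input₂⇒ParI i₂ a∉ =
    inj₂ i₂ , λ { (inj₁ o₁) → a∉ (inj₂ o₁) ; (inj₂ o₂) → IsIA.disjoint iQ _ i₂ o₂ }

  ParO-noMust : ∀ {s a} → ParO I₁ O₁ I₂ O₂ a → ¬ PMust M₁ M₂ s a
  ParO-noMust (_ , a∉I) (Must1 (emb i₁ _) _) = a∉I (inj₁ i₁)
  ParO-noMust (_ , a∉I) (Must2 (emb i₂ _) _) = a∉I (inj₂ i₂)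

  PMay⇒IAParStep : ∀ {s α s′} → PMay M₁ M₂ s α s′ → IAParStep I₁ O₁ I₂ O₂ P Q s α s′
  PMay⇒IAParStep (May1 tr a∉) = Par1 tr a∉
  PMay⇒IAParStep (May2 tr a∉) = Par2 tr a∉
  PMay⇒IAParStep (May3 tr₁ tr₂) = Par3 tr₁ tr₂

  IAParStep⇒PMay : ∀ {s α s′} → IAParStep I₁ O₁ I₂ O₂ P Q s α s′ → PMay M₁ M₂ s α s′
  IAParStep⇒PMay (Par1 tr a∉) = May1 tr a∉
  IAParStep⇒PMay (Par2 tr a∉) = May2 tr a∉
  IAParStep⇒PMay (Par3 tr₁ tr₂) = May3 tr₁ tr₂

  MIAE⇒IAE : ∀ {s} → MIAE M₁ M₂ s → IAE I₁ O₁ I₂ O₂ P Q s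
  MIAE⇒IAE (E-err (err1 a₁ a₂ o₁ tr noMust)) =
    E-err (err1 a₁ a₂ o₁ tr (λ _ tr′ → noMust (emb (sharedOutput₁⇒input₂ a₁ a₂ o₁) tr′)))
  MIAE⇒IAE (E-err (err2 a₁ a₂ o₂ tr noMust)) =
    E-err (err2 a₁ a₂ o₂ tr (λ _ tr′ → noMust (emb (sharedOutput₂⇒input₁ a₁ a₂ o₂) tr′)))
  MIAE⇒IAE (E-step ot step e) = E-step ot (PMay⇒IAParStep step) (MIAE⇒IAE e)

  IAE⇒MIAE : ∀ {s} → IAE I₁ O₁ I₂ O₂ P Q s → MIAE M₁ M₂ s
  IAE⇒MIAE (E-err (err1 a₁ a₂ o₁ tr noTr)) =
    E-err (err1 a₁ a₂ o₁ tr (λ { (emb _ tr′) → noTr _ tr′ }))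
  IAE⇒MIAE (E-err (err2 a₁ a₂ o₂ tr noTr)) =
    E-err (err2 a₁ a₂ o₂ tr (λ { (emb _ tr′) → noTr _ tr′ }))
  IAE⇒MIAE (E-step ot step e) = E-step ot (IAParStep⇒PMay step) (IAE⇒MIAE e)

  ¬IAE⇒¬MIAE : ∀ {s} → ¬ IAE I₁ O₁ I₂ O₂ P Q s → ¬ MIAE M₁ M₂ s
  ¬IAE⇒¬MIAE c e = c (MIAE⇒IAE e)

  ¬MIAE⇒¬IAE : ∀ {s} → ¬ MIAE M₁ M₂ s → ¬ IAE I₁ O₁ I₂ O₂ P Q s
  ¬MIAE⇒¬IAE c e = c (IAE⇒MIAE e)

  SameState : mSt Par → mSt E → Set
  SameState (s , _) (t , _) = s ≡ t

  SameState⁻¹ : mSt E → mSt Par → Set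
  SameState⁻¹ t x = SameState x t

  par⊑IAPar : IsMIARefinement Par E SameState
  par⊑IAPar = record
    { must-match = λ {x} {t} → must {x} {t}
    ; may-match  = λ {x} {t} {α} {x′} → may {x} {t} {α} {x′} }
    where
    must : ∀ {x t a} → SameState x t → (n : Must E t a) →
      Σ (Must Par x a) λ m → ∀ x′ → tgt Par {x} m x′ →
        Σ (mSt E) λ t′ → tgt E {t} n t′ × SameState x′ t′
    must refl (emb {_ , compatible} a∈ (Par1 tr a∉)) =
      (Must1 (emb (ParI-private₁ a∈ a∉) tr) a∉ ,
        λ { (_ , (refl , refl) , e) → ¬IAE⇒¬MIAE compatible e }) ,
      λ { _ (refl , refl) → _ , refl , refl }
    must refl (emb {_ , compatible} a∈ (Par2 tr a∉)) =
      (Must2 (emb (ParI-private₂ a∈ a∉) tr) a∉ ,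
        λ { (_ , (refl , refl) , e) → ¬IAE⇒¬MIAE compatible e }) ,
      λ { _ (refl , refl) → _ , refl , refl }

    may : ∀ {x t α x′} → SameState x t → OutTau (ParO I₁ O₁ I₂ O₂) α → May Par x α x′ →
      Σ (mSt E) λ t′ → WeakHat E t α t′ × SameState x′ t′
    may {x′ = _ , compatible} refl _ (step , _) =
      (_ , ¬MIAE⇒¬IAE compatible) , May⇒WeakHat E (PMay⇒IAParStep step) , refl

  IAPar⊑par : IsMIARefinement E Par SameState⁻¹
  IAPar⊑par = record
    { must-match = λ {x} {t} → must {x} {t}
    ; may-match  = λ {x} {t} {α} {x′} → may {x} {t} {α} {x′} }
    where
    must : ∀ {t x a} → SameState⁻¹ t x → (n : Must Par x a) →
      Σ (Must E t a) λ m → ∀ t′ → tgt E {t} m t′ →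
        Σ (mSt Par) λ x′ → tgt Par {x} n x′ × SameState⁻¹ t′ x′
    must refl (Must1 (emb i₁ tr) a∉ , notRemoved) =
      emb {p' = _ , λ e → notRemoved (_ , (refl , refl) , IAE⇒MIAE e)}
        (private-input₁⇒ParI i₁ a∉) (Par1 tr a∉) ,
      λ { _ refl → (_ , λ e → notRemoved (_ , (refl , refl) , e)) , (refl , refl) , refl }
    must refl (Must2 (emb i₂ tr) a∉ , notRemoved) =
      emb {p' = _ , λ e → notRemoved (_ , (refl , refl) , IAE⇒MIAE e)}
        (private-input₂⇒ParI i₂ a∉) (Par2 tr a∉) ,
      λ { _ refl → (_ , λ e → notRemoved (_ , (refl , refl) , e)) , (refl , refl) , refl }

    -- An output step survives pruning: no must-transition carries its label.
    may : ∀ {t x α t′} → SameState⁻¹ t x → OutTau (ParO I₁ O₁ I₂ O₂) α → May E t α t′ →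
      Σ (mSt Par) λ x′ → WeakHat Par x α x′ × SameState⁻¹ t′ x′
    may {t′ = _ , compatible} refl isτ step =
      (_ , ¬IAE⇒¬MIAE compatible) , May⇒WeakHat Par (IAParStep⇒PMay step , λ ()) , refl
    may {x = x} {t′ = _ , compatible} refl (isOut o) step =
      (_ , ¬IAE⇒¬MIAE compatible) ,
      (x , ε-refl , IAParStep⇒PMay step , λ (m , _) → ParO-noMust o m) , refl

  Embed-MIAPar-compatible-equiv :
    (p : St P) (q : St Q) (c : IACompatible I₁ O₁ I₂ O₂ P Q p q) →
    Σ (MIACompatible M₁ M₂ p q) λ c′ → MIAEq Par E ((p , q) , c′) ((p , q) , c)
  Embed-MIAPar-compatible-equiv p q c =
    ¬IAE⇒¬MIAE c , (SameState , par⊑IAPar , refl) , (SameState⁻¹ , IAPar⊑par , refl)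

theorem4p17 : {Act : Set} →
    ((I O : Pred Act) (P Q : LTS Act) → IsIA I O P → IsIA I O Q →
      (p : St P) (q : St Q) →
      Σ (ConjDefined (Embed I O P) (Embed I O Q) p q) λ d →
        MIAEq (MIAConj (Embed I O P) (Embed I O Q)) (Embed I O (IAConj I O P Q))
          (both p q , d) (both p q))
    ×
    ((I₁ O₁ I₂ O₂ : Pred Act) (P Q : LTS Act) → IsIA I₁ O₁ P → IsIA I₂ O₂ Q →
      Composable I₁ O₁ I₂ O₂ →
      (p : St P) (q : St Q) (c : IACompatible I₁ O₁ I₂ O₂ P Q p q) →
      Σ (MIACompatible (Embed I₁ O₁ P) (Embed I₂ O₂ Q) p q) λ c' →
        MIAEq (MIAPar (Embed I₁ O₁ P) (Embed I₂ O₂ Q))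
          (Embed (ParI I₁ O₁ I₂ O₂) (ParO I₁ O₁ I₂ O₂) (IAPar I₁ O₁ I₂ O₂ P Q))
          ((p , q) , c') ((p , q) , c))
theorem4p17 = Conjunction.Embed-MIAConj-defined-equiv , Parallel.Embed-MIAPar-compatible-equiv
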